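{- Let $S$ be a reflective numerical semigroup with genus $g(S)=g\ge1$ and multiplicity $m(S)=a$. Then: $S$ is symmetric if and only if $g\equiv1\pmod a$; $S$ is pseudo-symmetric if and only if $g\equiv 2\pmod a$; and $S$ is irreducible if and only if $g\equiv 1$ or $g\equiv 2\pmod a$.
   Context: A numerical semigroup is a submonoid $S$ of $(\mathbb{N}_0,+)$ with finite complement; $g(S)=\#(\mathbb{N}_0\setminus S)$, $m(S)$ is the smallest positive element of $S$, and $F(S)$ is the largest element of $\mathbb{N}_0\setminus S$. $S$ is symmetric if for all $z\in\mathbb{Z}$ exactly one of $z$ and $F(S)-z$ is in $S$; pseudo-symmetric if $F(S)$ is even and for all $z\in\mathbb{Z}\setminus\{F(S)/2\}$ exactly one of $z$ and $F(S)-z$ is in $S$; irreducible if $S$ is not the intersection of two numerical semigroups properly containing $S$. $S$ (with $g=g(S)\ge1$) is reflective if for every integer $z$ with $0\le z\le g-1$ exactly one of $z$ and $z+g$ lies in $S$. -}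

module Defs where

open import Data.Nat using (ℕ; zero; suc; _+_; _*_; _≤_; _<_)
open import Data.Bool using (Bool; true; false; _∧_; if_then_else_)
open import Data.Integer as ℤ using (ℤ; +_; -[1+_])
open import Data.Product using (Σ; _×_; ∃)
open import Relation.Binary.PropositionalEquality using (_≡_; _≢_)
open import Relation.Nullary using (¬_)

Subsetℕ : Set
Subsetℕ = ℕ → Bool

record IsNumericalSemigroup (S : Subsetℕ) : Set where
  field
    zero∈    : S 0 ≡ true
    +-closed : ∀ x y → S x ≡ true → S y ≡ true → S (x + y) ≡ true
    cofinite : Σ ℕ λ N → ∀ n → N ≤ n → S n ≡ true

gapsBelow : Subsetℕ → ℕ → ℕ
gapsBelow S zero    = 0
gapsBelow S (suc n) = gapsBelow S n + (if S n then 0 else 1)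

IsGenus : Subsetℕ → ℕ → Set
IsGenus S g = Σ ℕ λ N → (∀ n → N ≤ n → S n ≡ true) × gapsBelow S N ≡ g

IsMultiplicity : Subsetℕ → ℕ → Set
IsMultiplicity S a = (0 < a) × (S a ≡ true) × (∀ n → 0 < n → n < a → S n ≡ false)

IsFrobenius : Subsetℕ → ℕ → Set
IsFrobenius S F = (S F ≡ false) × (∀ n → F < n → S n ≡ true)

-- membership of an integer in S (negative integers are never in S ⊆ ℕ₀)
memℤ : Subsetℕ → ℤ → Bool
memℤ S (+ n)    = S n
memℤ S -[1+ n ] = false

ExactlyOne : Subsetℕ → ℤ → ℤ → Set
ExactlyOne S x y = memℤ S x ≢ memℤ S y

Symmetric : Subsetℕ → Set
Symmetric S = Σ ℕ λ F → IsFrobenius S F ×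
  (∀ (z : ℤ) → ExactlyOne S z (+ F ℤ.- z))

PseudoSymmetric : Subsetℕ → Set
PseudoSymmetric S = Σ ℕ λ F → IsFrobenius S F × Σ ℕ λ h → F ≡ 2 * h ×
  (∀ (z : ℤ) → z ≢ + h → ExactlyOne S z (+ F ℤ.- z))

ProperSuperset : Subsetℕ → Subsetℕ → Set
ProperSuperset T S = (∀ n → S n ≡ true → T n ≡ true) × Σ ℕ λ n → (T n ≡ true) × (S n ≡ false)

Irreducible : Subsetℕ → Set
Irreducible S = ¬ (Σ Subsetℕ λ T → Σ Subsetℕ λ U →
  IsNumericalSemigroup T × IsNumericalSemigroup U ×
  ProperSuperset T S × ProperSuperset U S × (∀ n → S n ≡ (T n ∧ U n)))

Reflective : Subsetℕ → ℕ → Set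
Reflective S g = ∀ z → z < g → S z ≢ S (z + g)

{-# OPTIONS --safe #-}

-- Write g = k + 1.  Reflectivity pushes all g gaps below 2g, and an induction
-- on z (subtracting a) shows that below g the semigroup consists exactly of the
-- multiples of a; hence z + g lies in S iff a ∤ z.  The gaps ≥ g are therefore
-- the r + g with a ∣ r < g, and the Frobenius number is c + g for the largest
-- such c.  If a ∣ k then F = k + g = 2g - 1 and z ↔ F - z swaps the two halves
-- [0, g) and [g, 2g) compatibly with "a ∣ _", so S is symmetric.  If a ∤ k but
-- a ∣ k - 1 the same pairing works around F = 2k, with k as the fixed point.
-- Conversely, F - k = r + 1 for some r with a ∣ r, so F - k is always a gap,
-- which forces k ∈ S (symmetric case) or k = F/2 (pseudo-symmetric case).
-- If neither a ∣ k nor a ∣ k - 1, then S = (S ∪ [g, ∞)) ∩ (S ∪ {k}).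
module Submission where

open import Defs
open import Data.Nat using (ℕ; _≤_)
open import Data.Integer using (+_; _-_)
open import Data.Integer.Divisibility using (_∣_)
open import Data.Product using (_×_)
open import Data.Sum using (_⊎_)
open import Function.Bundles using (_⇔_)

open import Data.Bool using (Bool; true; false; not; _∧_; _∨_; if_then_else_)
open import Data.Bool.Properties using (¬-not; not-¬; not-involutive; not-injective; ∧-zeroʳ; ∨-zeroʳ)
open import Data.Nat
  using (zero; suc; _+_; _*_; _∸_; _<_; _≤′_; ≤′-refl; ≤′-step; z<s; _≟_; _≤?_; _<?_)
open import Data.Nat.Properties
open import Data.Nat.Divisibility as ℕ
  using (divides; _∣?_; _∣0; ∣m+n∣m⇒∣n; ∣m∸n∣n⇒∣m; ∣-refl; ∣-trans; 1∣_)
open import Data.Nat.Induction using (<-rec)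
open import Data.Integer as ℤ using (-[1+_])
open import Data.Integer.Properties using ([+m]-[+n]≡m⊖n; ⊖-≥; ⊖-<; +-injective)
open import Algebra.Properties.CommutativeSemigroup +-commutativeSemigroup using (interchange; xy∙z≈xz∙y)
open import Data.Product using (_,_; proj₁; proj₂)
open import Data.Sum using (inj₁; inj₂; [_,_])
open import Function using (_∘_)
open import Function.Bundles using (mk⇔; Equivalence)
open import Relation.Nullary using (¬_; yes; no; contradiction)
open import Relation.Nullary.Decidable using (Dec; does; dec-true; dec-false; does-⇔)
open import Relation.Binary.Definitions using (tri<; tri≈; tri>)
open import Relation.Binary.PropositionalEquality hiding ([_])

true≢false : true ≢ false
true≢false ()

∨-≡-true⁻ : ∀ b {c} → b ∨ c ≡ true → b ≡ true ⊎ c ≡ true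
∨-≡-true⁻ true  _ = inj₁ refl
∨-≡-true⁻ false c = inj₂ c

does-≡-true⁻ : ∀ {A : Set} (A? : Dec A) → does A? ≡ true → A
does-≡-true⁻ (yes a) _ = a

mem-of-∣ : ∀ {S a n} → IsNumericalSemigroup S → S a ≡ true → a ℕ.∣ n → S n ≡ true
mem-of-∣ {S} {a} ns a∈S (divides q refl) = mem-* q
  where
  mem-* : ∀ q → S (q * a) ≡ true
  mem-* zero    = IsNumericalSemigroup.zero∈ ns
  mem-* (suc q) = IsNumericalSemigroup.+-closed ns a (q * a) a∈S (mem-* q)

gap : Bool → ℕ
gap b = if b then 0 else 1

gapsBelow-mono : ∀ S {m n} → m ≤′ n → gapsBelow S m ≤ gapsBelow S n
gapsBelow-mono S ≤′-refl        = ≤-refl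
gapsBelow-mono S (≤′-step m≤′n) = ≤-trans (gapsBelow-mono S m≤′n) (m≤m+n _ _)

gapsBelow-stable : ∀ S {N n} → (∀ m → N ≤ m → S m ≡ true) → N ≤′ n →
                   gapsBelow S n ≡ gapsBelow S N
gapsBelow-stable S tail ≤′-refl = refl
gapsBelow-stable S {N} tail (≤′-step {n} N≤′n) = begin
  gapsBelow S n + gap (S n) ≡⟨ cong (λ b → gapsBelow S n + gap b) (tail n (≤′⇒≤ N≤′n)) ⟩
  gapsBelow S n + 0         ≡⟨ +-identityʳ _ ⟩
  gapsBelow S n             ≡⟨ gapsBelow-stable S tail N≤′n ⟩
  gapsBelow S N             ∎
  where open ≡-Reasoning

gapsBelow≤genus : ∀ {S g} → IsGenus S g → ∀ n → gapsBelow S n ≤ g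
gapsBelow≤genus {S} {g} (N , tail , G[N]≡g) n = begin
  gapsBelow S n       ≤⟨ gapsBelow-mono S (≤⇒≤′ (m≤m+n n N)) ⟩
  gapsBelow S (n + N) ≡⟨ gapsBelow-stable S tail (≤⇒≤′ (m≤n+m N n)) ⟩
  gapsBelow S N       ≡⟨ G[N]≡g ⟩
  g                   ∎
  where open ≤-Reasoning

mem-beyond-genus : ∀ {S g n m} → IsGenus S g → g ≤ gapsBelow S n → n ≤ m → S m ≡ true
mem-beyond-genus {S} {g} {n} {m} genus g≤G n≤m with S m in m∉S
... | true  = refl
... | false = contradiction (gapsBelow≤genus genus (suc m)) (<⇒≱ g<G)
  where
  g<G : g < gapsBelow S (suc m)
  g<G = begin-strict
    g                   ≤⟨ g≤G ⟩
    gapsBelow S n       ≤⟨ gapsBelow-mono S (≤⇒≤′ n≤m) ⟩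
    gapsBelow S m       <⟨ m<m+n _ z<s ⟩
    gapsBelow S m + 1   ≡⟨ cong (λ b → gapsBelow S m + gap b) m∉S ⟨
    gapsBelow S (suc m) ∎
    where open ≤-Reasoning

frobenius-unique : ∀ {S F F′} → IsFrobenius S F → IsFrobenius S F′ → F ≡ F′
frobenius-unique {F = F} {F′} (F∉S , >F∈S) (F′∉S , >F′∈S) with <-cmp F F′
... | tri< F<F′ _ _ = contradiction (trans (sym (>F∈S _ F<F′)) F′∉S) true≢false
... | tri≈ _ F≡F′ _ = F≡F′
... | tri> _ _ F′<F = contradiction (trans (sym (>F′∈S _ F′<F)) F∉S) true≢false

memℤ-[+F]-[+n] : ∀ S {F n} → n ≤ F → memℤ S (+ F - + n) ≡ S (F ∸ n)
memℤ-[+F]-[+n] S {F} {n} n≤F = cong (memℤ S) (trans ([+m]-[+n]≡m⊖n F n) (⊖-≥ n≤F))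

memℤ-negative : ∀ S {x} → 0 < x → memℤ S (ℤ.- + x) ≡ false
memℤ-negative S {suc x} _ = refl

exactlyOne-ℕ : ∀ {S F n} → n ≤ F → ExactlyOne S (+ n) (+ F - + n) → S n ≢ S (F ∸ n)
exactlyOne-ℕ {S} {n = n} n≤F = subst (S n ≢_) (memℤ-[+F]-[+n] S n≤F)

exactlyOne-frobenius : ∀ {S F} → IsFrobenius S F → ∀ z →
  (∀ n → z ≡ + n → n ≤ F → S n ≢ S (F ∸ n)) → ExactlyOne S z (+ F - z)
exactlyOne-frobenius {S} {F} (_ , >F∈S) -[1+ n ] _ z∈S≡F-z∈S =
  true≢false (sym (trans z∈S≡F-z∈S (>F∈S (F + suc n) (m<m+n F z<s))))
exactlyOne-frobenius {S} {F} (_ , >F∈S) (+ n) paired with n ≤? F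
... | yes n≤F = subst (S n ≢_) (sym (memℤ-[+F]-[+n] S n≤F)) (paired n refl n≤F)
... | no n≰F  = λ n∈S≡F-n∈S → true≢false
  (trans (sym (>F∈S n (≰⇒> n≰F))) (trans n∈S≡F-n∈S F-n∉S))
  where
  F-n∉S : memℤ S (+ F - + n) ≡ false
  F-n∉S = trans (cong (memℤ S) (trans ([+m]-[+n]≡m⊖n F n) (⊖-< (≰⇒> n≰F))))
                (memℤ-negative S (m<n⇒0<n∸m (≰⇒> n≰F)))

superset-∋-frobenius : ∀ {S T F} → IsFrobenius S F →
  (∀ x → S x ≡ false → x ≤ F → S (F ∸ x) ≡ true ⊎ x + x ≡ F) →
  IsNumericalSemigroup T → ProperSuperset T S → T F ≡ true
superset-∋-frobenius {S} {T} {F} (_ , >F∈S) paired T-ns (S⊆T , x , x∈T , x∉S) with x ≤? F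
... | no x≰F = contradiction (trans (sym (>F∈S x (≰⇒> x≰F))) x∉S) true≢false
... | yes x≤F with paired x x∉S x≤F
...   | inj₁ F-x∈S = subst (λ n → T n ≡ true) (m∸n+n≡m x≤F)
                       (IsNumericalSemigroup.+-closed T-ns _ x (S⊆T _ F-x∈S) x∈T)
...   | inj₂ x+x≡F = subst (λ n → T n ≡ true) x+x≡F (IsNumericalSemigroup.+-closed T-ns x x x∈T x∈T)

-- Any numerical semigroup strictly above S contains F, hence so does any intersection of two.
irreducible-of-paired-gaps : ∀ {S F} → IsFrobenius S F →
  (∀ x → S x ≡ false → x ≤ F → S (F ∸ x) ≡ true ⊎ x + x ≡ F) → Irreducible S
irreducible-of-paired-gaps {S} {F} fr paired (T , U , T-ns , U-ns , T⊃S , U⊃S , S≡T∧U) =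
  true≢false (begin
    true      ≡⟨ cong₂ _∧_ F∈T F∈U ⟨
    T F ∧ U F ≡⟨ S≡T∧U F ⟨
    S F       ≡⟨ proj₁ fr ⟩
    false     ∎)
  where
  open ≡-Reasoning
  F∈T = superset-∋-frobenius fr paired T-ns T⊃S
  F∈U = superset-∋-frobenius fr paired U-ns U⊃S

partner-∈ : ∀ {S F x} → ExactlyOne S (+ x) (+ F - + x) → x ≤ F → S x ≡ false → S (F ∸ x) ≡ true
partner-∈ exactlyOne x≤F x∉S = trans (¬-not (≢-sym (exactlyOne-ℕ x≤F exactlyOne))) (cong not x∉S)

symmetric⇒irreducible : ∀ {S} → Symmetric S → Irreducible S
symmetric⇒irreducible (F , fr , exactlyOne) =
  irreducible-of-paired-gaps fr λ x x∉S x≤F → inj₁ (partner-∈ (exactlyOne (+ x)) x≤F x∉S)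

pseudoSymmetric⇒irreducible : ∀ {S} → PseudoSymmetric S → Irreducible S
pseudoSymmetric⇒irreducible {S} (F , fr , h , F≡2h , exactlyOne) = irreducible-of-paired-gaps fr paired
  where
  paired : ∀ x → S x ≡ false → x ≤ F → S (F ∸ x) ≡ true ⊎ x + x ≡ F
  paired x x∉S x≤F with x ≟ h
  ... | yes refl = inj₂ (sym (trans F≡2h (cong (_+_ x) (+-identityʳ x))))
  ... | no x≢h   = inj₁ (partner-∈ (exactlyOne (+ x) (x≢h ∘ +-injective)) x≤F x∉S)

_∪≥_ : Subsetℕ → ℕ → Subsetℕ
(S ∪≥ N) n = S n ∨ does (N ≤? n)

insert : ℕ → Subsetℕ → Subsetℕ
insert x S n = S n ∨ does (n ≟ x)

∪≥-∋-≥ : ∀ S {N n} → N ≤ n → (S ∪≥ N) n ≡ true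
∪≥-∋-≥ S {N} {n} N≤n = trans (cong (S n ∨_) (dec-true (N ≤? n) N≤n)) (∨-zeroʳ (S n))

∪≥-isNumericalSemigroup : ∀ {S} → IsNumericalSemigroup S → ∀ N → IsNumericalSemigroup (S ∪≥ N)
∪≥-isNumericalSemigroup {S} ns N = record
  { zero∈    = cong (_∨ _) (IsNumericalSemigroup.zero∈ ns)
  ; +-closed = closed
  ; cofinite = N , λ n → ∪≥-∋-≥ S
  }
  where
  closed : ∀ x y → (S ∪≥ N) x ≡ true → (S ∪≥ N) y ≡ true → (S ∪≥ N) (x + y) ≡ true
  closed x y x∈ y∈ with ∨-≡-true⁻ (S x) x∈ | ∨-≡-true⁻ (S y) y∈
  ... | inj₁ x∈S | inj₁ y∈S = cong (_∨ _) (IsNumericalSemigroup.+-closed ns x y x∈S y∈S)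
  ... | inj₂ N≤x | _        = ∪≥-∋-≥ S (≤-trans (does-≡-true⁻ (N ≤? x) N≤x) (m≤m+n x y))
  ... | inj₁ _   | inj₂ N≤y = ∪≥-∋-≥ S (≤-trans (does-≡-true⁻ (N ≤? y) N≤y) (m≤n+m y x))

insert-∋ : ∀ x S → insert x S x ≡ true
insert-∋ x S = trans (cong (S x ∨_) (dec-true (x ≟ x) refl)) (∨-zeroʳ (S x))

insert-isNumericalSemigroup : ∀ {S} → IsNumericalSemigroup S → ∀ x → S (x + x) ≡ true →
  (∀ y → 0 < y → S y ≡ true → S (x + y) ≡ true) → IsNumericalSemigroup (insert x S)
insert-isNumericalSemigroup {S} ns x x+x∈S x+S⊆S = record
  { zero∈    = cong (_∨ _) (IsNumericalSemigroup.zero∈ ns)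
  ; +-closed = closed
  ; cofinite = proj₁ cofinite , λ n N≤n → cong (_∨ _) (proj₂ cofinite n N≤n)
  }
  where
  open IsNumericalSemigroup ns using (+-closed; cofinite)

  x+-∈ : ∀ y → S y ≡ true → insert x S (x + y) ≡ true
  x+-∈ zero    _   = subst (λ n → insert x S n ≡ true) (sym (+-identityʳ x)) (insert-∋ x S)
  x+-∈ (suc y) y∈S = cong (_∨ _) (x+S⊆S (suc y) z<s y∈S)

  closed : ∀ u v → insert x S u ≡ true → insert x S v ≡ true → insert x S (u + v) ≡ true
  closed u v u∈ v∈ with ∨-≡-true⁻ (S u) u∈ | ∨-≡-true⁻ (S v) v∈
  ... | inj₁ u∈S | inj₁ v∈S = cong (_∨ _) (+-closed u v u∈S v∈S)
  ... | inj₂ u≡x | inj₁ v∈S rewrite does-≡-true⁻ (u ≟ x) u≡x = x+-∈ v v∈S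
  ... | inj₁ u∈S | inj₂ v≡x rewrite does-≡-true⁻ (v ≟ x) v≡x | +-comm u x = x+-∈ u u∈S
  ... | inj₂ u≡x | inj₂ v≡x rewrite does-≡-true⁻ (u ≟ x) u≡x | does-≡-true⁻ (v ≟ x) v≡x =
    cong (_∨ _) x+x∈S

∪≥-∧-insert : ∀ S {x N} → x < N → ∀ n → S n ≡ ((S ∪≥ N) n ∧ insert x S n)
∪≥-∧-insert S {x} {N} x<N n with S n | n ≟ x
... | true  | _        = refl
... | false | no n≢x   = sym (trans (cong (does (N ≤? n) ∧_) (dec-false (n ≟ x) n≢x)) (∧-zeroʳ _))
... | false | yes refl = sym (cong (_∧ _) (dec-false (N ≤? x) (<⇒≱ x<N)))

module ReflectiveSemigroup {S : Subsetℕ} {k a : ℕ} (ns : IsNumericalSemigroup S)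
  (genus : IsGenus S (suc k)) (multiplicity : IsMultiplicity S a) (reflective : Reflective S (suc k))
  where

  open IsNumericalSemigroup ns

  g : ℕ
  g = suc k

  0<a : 0 < a
  0<a = proj₁ multiplicity

  a∈S : S a ≡ true
  a∈S = proj₁ (proj₂ multiplicity)

  ∉-strictly-below-a : ∀ n → 0 < n → n < a → S n ≡ false
  ∉-strictly-below-a = proj₂ (proj₂ multiplicity)

  ∣⇒∈ : ∀ {n} → a ℕ.∣ n → S n ≡ true
  ∣⇒∈ = mem-of-∣ ns a∈S

  mem-shift : ∀ {z} → z < g → S (z + g) ≡ not (S z)
  mem-shift {z} z<g = ¬-not (≢-sym (reflective z z<g))

  g∉S : S g ≡ false
  g∉S = trans (mem-shift z<s) (cong not zero∈)

  a∤1 : ¬ a ℕ.∣ 1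
  a∤1 a∣1 = true≢false (trans (sym (∣⇒∈ (∣-trans a∣1 (1∣ g)))) g∉S)

  ¬∣-consecutive : ∀ {r} → a ℕ.∣ r → ¬ a ℕ.∣ suc r
  ¬∣-consecutive {r} a∣r a∣r+1 = a∤1 (∣m+n∣m⇒∣n (subst (a ℕ.∣_) (+-comm 1 r) a∣r+1) a∣r)

  -- If z - a were a gap, z - a + g would be in S, and then so would z + g.
  ∈⇒∸a-∈ : ∀ {z} → z < g → a ≤ z → S z ≡ true → S (z ∸ a) ≡ true
  ∈⇒∸a-∈ {z} z<g a≤z z∈S with S (z ∸ a) in z-a∉S
  ... | true  = refl
  ... | false = contradiction (trans (sym z+g∈S) (trans (mem-shift z<g) (cong not z∈S))) true≢false
    where
    z-a<g : z ∸ a < g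
    z-a<g = ≤-<-trans (m∸n≤m z a) z<g

    z+g∈S : S (z + g) ≡ true
    z+g∈S = subst (λ n → S n ≡ true) (trans (xy∙z≈xz∙y (z ∸ a) g a) (cong (_+ g) (m∸n+n≡m a≤z)))
      (+-closed _ a (trans (mem-shift z-a<g) (cong not z-a∉S)) a∈S)

  ∈⇒∣ : ∀ z → z < g → S z ≡ true → a ℕ.∣ z
  ∈⇒∣ = <-rec (λ z → z < g → S z ≡ true → a ℕ.∣ z) step
    where
    step : ∀ z → (∀ {y} → y < z → y < g → S y ≡ true → a ℕ.∣ y) → z < g → S z ≡ true → a ℕ.∣ z
    step zero    _  _   _   = a ∣0
    step (suc z) ih z<g z∈S with a ≤? suc z
    ... | no a≰z  =
      contradiction (trans (sym z∈S) (∉-strictly-below-a (suc z) z<s (≰⇒> a≰z))) true≢false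
    ... | yes a≤z = ∣m∸n∣n⇒∣m a a≤z
      (ih (∸-monoʳ-< 0<a a≤z) (≤-<-trans (m∸n≤m (suc z) a) z<g) (∈⇒∸a-∈ z<g a≤z z∈S)) ∣-refl

  ∤⇒∉ : ∀ {z} → z < g → ¬ a ℕ.∣ z → S z ≡ false
  ∤⇒∉ {z} z<g a∤z with S z in z∈S
  ... | false = refl
  ... | true  = contradiction (∈⇒∣ z z<g z∈S) a∤z

  mem-below-g : ∀ {z} → z < g → S z ≡ does (a ∣? z)
  mem-below-g {z} z<g with a ∣? z
  ... | yes a∣z = ∣⇒∈ a∣z
  ... | no  a∤z = ∤⇒∉ z<g a∤z

  mem-≡-of-∣+ : ∀ {m n} → a ℕ.∣ m + n → m < g → n < g → S m ≡ S n
  mem-≡-of-∣+ {m} {n} a∣m+n m<g n<g =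
    trans (mem-below-g m<g) (trans (does-⇔ a∣m⇔a∣n (a ∣? m) (a ∣? n)) (sym (mem-below-g n<g)))
    where
    a∣m⇔a∣n : a ℕ.∣ m ⇔ a ℕ.∣ n
    a∣m⇔a∣n = mk⇔ (∣m+n∣m⇒∣n a∣m+n) (∣m+n∣m⇒∣n (subst (a ℕ.∣_) (+-comm m n) a∣m+n))

  gapsBelow-halves : ∀ j → j ≤ g → gapsBelow S j + gapsBelow S (j + g) ≡ j + gapsBelow S g
  gapsBelow-halves zero    _      = refl
  gapsBelow-halves (suc j) j+1≤g = begin
    (G j + gap (S j)) + (G (j + g) + gap (S (j + g))) ≡⟨ interchange (G j) _ (G (j + g)) _ ⟩
    (G j + G (j + g)) + (gap (S j) + gap (S (j + g))) ≡⟨ cong₂ _+_ ih one-gap ⟩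
    (j + G g) + 1                                     ≡⟨ +-comm _ 1 ⟩
    suc j + G g                                       ∎
    where
    open ≡-Reasoning
    G = gapsBelow S
    ih = gapsBelow-halves j (<⇒≤ j+1≤g)

    one-gap : gap (S j) + gap (S (j + g)) ≡ 1
    one-gap rewrite mem-shift j+1≤g with S j
    ... | true  = refl
    ... | false = refl

  ≥2g⇒∈ : ∀ {n} → g + g ≤ n → S n ≡ true
  ≥2g⇒∈ = mem-beyond-genus genus (≤-reflexive (sym G[2g]≡g))
    where
    G[2g]≡g : gapsBelow S (g + g) ≡ g
    G[2g]≡g = +-cancelˡ-≡ (gapsBelow S g) _ _
      (trans (gapsBelow-halves g ≤-refl) (+-comm g (gapsBelow S g)))

  g≤frobenius : ∀ {F} → IsFrobenius S F → g ≤ F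
  g≤frobenius (_ , >F∈S) = ≮⇒≥ λ F<g → true≢false (trans (sym (>F∈S g F<g)) g∉S)

  frobenius<2g : ∀ {F} → IsFrobenius S F → F < g + g
  frobenius<2g (F∉S , _) = ≰⇒> λ 2g≤F → true≢false (trans (sym (≥2g⇒∈ 2g≤F)) F∉S)

  shift-∉⇒suc-∉ : ∀ {r} → r < g → S (r + g) ≡ false → S (suc r) ≡ false
  shift-∉⇒suc-∉ {r} r<g r+g∉S with suc r <? g
  ... | yes r+1<g = ∤⇒∉ r+1<g (¬∣-consecutive (∈⇒∣ r r<g r∈S))
    where
    r∈S : S r ≡ true
    r∈S = not-injective (trans (sym (mem-shift r<g)) r+g∉S)
  ... | no  r+1≮g = subst (λ n → S n ≡ false) (sym (≤-antisym r<g (≮⇒≥ r+1≮g))) g∉S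

  frobenius∸k-∉ : ∀ {F} → IsFrobenius S F → S (F ∸ k) ≡ false
  frobenius∸k-∉ {F} fr = subst (λ n → S n ≡ false) r+1≡F∸k
    (shift-∉⇒suc-∉ r<g (subst (λ n → S n ≡ false) F≡r+g (proj₁ fr)))
    where
    r = F ∸ g
    F≡r+g : F ≡ r + g
    F≡r+g = sym (m∸n+n≡m (g≤frobenius fr))
    r<g : r < g
    r<g = +-cancelʳ-< g r g (subst (_< g + g) F≡r+g (frobenius<2g fr))
    r+1≡F∸k : suc r ≡ F ∸ k
    r+1≡F∸k = sym (trans (cong (_∸ k) (trans F≡r+g (+-suc r k))) (m+n∸n≡m (suc r) k))

  ∣k-of-partner : ∀ {F} → IsFrobenius S F → ExactlyOne S (+ k) (+ F - + k) → a ℕ.∣ k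
  ∣k-of-partner fr exactlyOne = ∈⇒∣ k ≤-refl
    (trans (¬-not (exactlyOne-ℕ k≤F exactlyOne)) (cong not (frobenius∸k-∉ fr)))
    where
    k≤F = ≤-trans (n≤1+n k) (g≤frobenius fr)

  frobenius-shift : ∀ {c} → a ℕ.∣ c → c < g → (∀ m → c < m → m < g → ¬ a ℕ.∣ m) →
                    IsFrobenius S (c + g)
  frobenius-shift {c} a∣c c<g no-multiple = trans (mem-shift c<g) (cong not (∣⇒∈ a∣c)) , above
    where
    above : ∀ n → c + g < n → S n ≡ true
    above n c+g<n with n <? g + g
    ... | no  n≮2g = ≥2g⇒∈ (≮⇒≥ n≮2g)
    ... | yes n<2g = subst (λ x → S x ≡ true) (m∸n+n≡m g≤n)
      (trans (mem-shift m<g) (cong not (∤⇒∉ m<g (no-multiple m c<m m<g))))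
      where
      g≤n = ≤-trans (m≤n+m g c) (<⇒≤ c+g<n)
      m   = n ∸ g
      c<m : c < m
      c<m = +-cancelʳ-< g c m (subst (c + g <_) (sym (m∸n+n≡m g≤n)) c+g<n)
      m<g : m < g
      m<g = +-cancelʳ-< g m g (subst (_< g + g) (sym (m∸n+n≡m g≤n)) n<2g)

  frobenius-k : a ℕ.∣ k → IsFrobenius S (k + g)
  frobenius-k a∣k = frobenius-shift a∣k ≤-refl λ m k<m m<g _ → <⇒≱ k<m (≤-pred m<g)

  -- For F = c + g the map n ↦ F - n swaps [0, c] with [g, F].
  frobenius-pairing : ∀ {c} → a ℕ.∣ c → c < g → ∀ n → n ≤ c + g → (n < g → n ≤ c) →
                      S n ≢ S (c + g ∸ n)
  frobenius-pairing {c} a∣c c<g n n≤F low n∈S≡F-n∈S = not-¬ refl (trans n∈S≡F-n∈S mem-F∸n)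
    where
    mem-F∸n : S (c + g ∸ n) ≡ not (S n)
    mem-F∸n with n <? g
    ... | yes n<g = begin
      S (c + g ∸ n)     ≡⟨ cong S (+-∸-comm g n≤c) ⟩
      S ((c ∸ n) + g)   ≡⟨ mem-shift (≤-<-trans (m∸n≤m c n) c<g) ⟩
      not (S (c ∸ n))   ≡⟨ cong not (mem-≡-of-∣+ a∣[c∸n]+n (≤-<-trans (m∸n≤m c n) c<g) n<g) ⟩
      not (S n)         ∎
      where
      open ≡-Reasoning
      n≤c = low n<g
      a∣[c∸n]+n = subst (a ℕ.∣_) (sym (m∸n+n≡m n≤c)) a∣c
    ... | no  n≮g = begin
      S (c + g ∸ n)     ≡⟨ cong S c+g∸n≡c∸m ⟩
      S (c ∸ m)         ≡⟨ mem-≡-of-∣+ a∣[c∸m]+m (≤-<-trans (m∸n≤m c m) c<g) m<g ⟩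
      S m               ≡⟨ not-involutive (S m) ⟨
      not (not (S m))   ≡⟨ cong not (mem-shift m<g) ⟨
      not (S (m + g))   ≡⟨ cong (not ∘ S) (m∸n+n≡m g≤n) ⟩
      not (S n)         ∎
      where
      open ≡-Reasoning
      g≤n = ≮⇒≥ n≮g
      m   = n ∸ g
      m≤c : m ≤ c
      m≤c = +-cancelʳ-≤ g m c (subst (_≤ c + g) (sym (m∸n+n≡m g≤n)) n≤F)
      m<g = ≤-<-trans m≤c c<g
      a∣[c∸m]+m = subst (a ℕ.∣_) (sym (m∸n+n≡m m≤c)) a∣c
      c+g∸n≡c∸m : c + g ∸ n ≡ c ∸ m
      c+g∸n≡c∸m = begin
        c + g ∸ n         ≡⟨ cong (c + g ∸_) (m∸n+n≡m g≤n) ⟨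
        c + g ∸ (m + g)   ≡⟨ cong₂ _∸_ (+-comm c g) (+-comm m g) ⟩
        g + c ∸ (g + m)   ≡⟨ [m+n]∸[m+o]≡n∸o g c m ⟩
        c ∸ m             ∎

  symmetric⇔ : Symmetric S ⇔ a ℕ.∣ k
  symmetric⇔ = mk⇔ (λ (F , fr , exactlyOne) → ∣k-of-partner fr (exactlyOne (+ k))) λ a∣k →
    k + g , frobenius-k a∣k , λ z → exactlyOne-frobenius (frobenius-k a∣k) z
      λ n _ n≤F → frobenius-pairing a∣k ≤-refl n n≤F ≤-pred

  pseudoSymmetric⇒∤k : PseudoSymmetric S → ¬ a ℕ.∣ k
  pseudoSymmetric⇒∤k (F , fr , h , F≡2h , _) a∣k = even≢odd h k (begin
    2 * h         ≡⟨ F≡2h ⟨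
    F             ≡⟨ frobenius-unique fr (frobenius-k a∣k) ⟩
    k + suc k     ≡⟨ +-suc k k ⟩
    suc (k + k)   ≡⟨ cong (suc ∘ (_+_ k)) (+-identityʳ k) ⟨
    suc (2 * k)   ∎)
    where open ≡-Reasoning

  pseudoSymmetric⇔ : ∀ {k′} → k ≡ suc k′ → PseudoSymmetric S ⇔ a ℕ.∣ k′
  pseudoSymmetric⇔ {k′} refl = mk⇔ to from
    where
    2k≡k′+g : 2 * k ≡ k′ + g
    2k≡k′+g = trans (cong (suc ∘ (_+_ k′) ∘ suc) (+-identityʳ k′)) (sym (+-suc k′ k))

    to : PseudoSymmetric S → a ℕ.∣ k′
    to ps@(F , fr , h , F≡2h , exactlyOne) with k ≟ h
    ... | no k≢h  = contradiction (∣k-of-partner fr (exactlyOne (+ k) (k≢h ∘ +-injective)))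
                                  (pseudoSymmetric⇒∤k ps)
    ... | yes refl = ∈⇒∣ k′ (n≤1+n k) (not-injective (trans (sym (mem-shift (n≤1+n k)))
                       (subst (λ n → S n ≡ false) (trans F≡2h 2k≡k′+g) (proj₁ fr))))

    from : a ℕ.∣ k′ → PseudoSymmetric S
    from a∣k′ = k′ + g , fr , k , sym 2k≡k′+g , λ z z≢k →
      exactlyOne-frobenius fr z λ n z≡n n≤F → frobenius-pairing a∣k′ k′<g n n≤F λ n<g →
        ≤-pred (≤∧≢⇒< (≤-pred n<g) λ n≡k → z≢k (trans z≡n (cong +_ n≡k)))
      where
      k′<g = n≤1+n k
      fr = frobenius-shift a∣k′ k′<g λ m k′<m m<g →
        subst (λ x → ¬ a ℕ.∣ x) (≤-antisym k′<m (≤-pred m<g)) (¬∣-consecutive a∣k′)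

  k+∈ : ∀ y → 0 < y → S y ≡ true → S (k + y) ≡ true
  k+∈ (suc y) _ y+1∈S with suc y <? g
  ... | yes y+1<g = subst (λ n → S n ≡ true) (trans (+-suc y k) (+-comm (suc y) k))
        (trans (mem-shift y<g) (cong not (∤⇒∉ y<g a∤y)))
    where
    y<g = <-trans (n<1+n y) y+1<g
    a∤y : ¬ a ℕ.∣ y
    a∤y a∣y = ¬∣-consecutive a∣y (∈⇒∣ (suc y) y+1<g y+1∈S)
  ... | no  y+1≮g = ≥2g⇒∈ (subst (_≤ k + suc y) (+-suc k g) (+-monoʳ-≤ k g<y+1))
    where
    g≢y+1 : g ≢ suc y
    g≢y+1 g≡y+1 = true≢false (trans (sym y+1∈S) (trans (cong S (sym g≡y+1)) g∉S))
    g<y+1 : g < suc y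
    g<y+1 = ≤∧≢⇒< (≮⇒≥ y+1≮g) g≢y+1

  irreducible⇒ : ∀ {k′} → k ≡ suc k′ → Irreducible S → a ℕ.∣ k ⊎ a ℕ.∣ k′
  irreducible⇒ {k′} refl irreducible with a ∣? k | a ∣? k′
  ... | yes a∣k | _        = inj₁ a∣k
  ... | no _    | yes a∣k′ = inj₂ a∣k′
  ... | no a∤k  | no a∤k′  = contradiction
    ( S ∪≥ g , insert k S
    , ∪≥-isNumericalSemigroup ns g , insert-isNumericalSemigroup ns k k+k∈S k+∈
    , ((λ n n∈S → cong (_∨ _) n∈S) , g , ∪≥-∋-≥ S ≤-refl , g∉S)
    , ((λ n n∈S → cong (_∨ _) n∈S) , k , insert-∋ k S , ∤⇒∉ ≤-refl a∤k)
    , ∪≥-∧-insert S ≤-refl )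
    irreducible
    where
    k+k∈S : S (k + k) ≡ true
    k+k∈S = subst (λ n → S n ≡ true) (+-suc k′ k)
      (trans (mem-shift (n≤1+n k)) (cong not (∤⇒∉ (n≤1+n k) a∤k′)))

corollary4p7 : (S : Subsetℕ) (g a : ℕ) → IsNumericalSemigroup S → IsGenus S g →
    1 ≤ g → IsMultiplicity S a → Reflective S g →
    (Symmetric S ⇔ (+ a ∣ (+ g - + 1)))
    × (PseudoSymmetric S ⇔ (+ a ∣ (+ g - + 2)))
    × (Irreducible S ⇔ ((+ a ∣ (+ g - + 1)) ⊎ (+ a ∣ (+ g - + 2))))
corollary4p7 S zero a _ _ () _ _
corollary4p7 S (suc zero) a ns genus _ multiplicity reflective =
  symmetric⇔ ,
  mk⇔ (λ ps → contradiction (a ∣0) (pseudoSymmetric⇒∤k ps)) (λ a∣1 → contradiction a∣1 a∤1) ,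
  mk⇔ (λ _ → inj₁ (a ∣0)) (λ _ → symmetric⇒irreducible (Equivalence.from symmetric⇔ (a ∣0)))
  where open ReflectiveSemigroup ns genus multiplicity reflective
corollary4p7 S (suc (suc k′)) a ns genus _ multiplicity reflective =
  symmetric⇔ ,
  pseudoSymmetric⇔ refl ,
  mk⇔ (irreducible⇒ refl)
      [ symmetric⇒irreducible ∘ Equivalence.from symmetric⇔
      , pseudoSymmetric⇒irreducible ∘ Equivalence.from (pseudoSymmetric⇔ refl) ]
  where open ReflectiveSemigroup ns genus multiplicity reflective
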